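{- If $G$ is a connected planar graph with maximum degree $4$ and $G^*$ is the graph constructed from $G$ as described in the context, then $G^*$ has average degree at most $7$.
   Context: Construction of $G^*$: let $G$ have vertices $u_1,\dots,u_n$. Add new vertices $u'_1,\dots,u'_n$ and, for every edge $u_iu_j$ of $G$, add the edges $u'_iu'_j$, $u'_iu_j$ and $u_iu'_j$. For each $i\in\{1,\dots,n\}$ add a gadget $X_i$ consisting of a vertex $x_i$ and two independent sets $A_i=\{x_{i,1},\dots,x_{i,n-1}\}$ and $B_i=\{x'_{i,1},\dots,x'_{i,n+2}\}$, with $x_i$ adjacent to every vertex of $A_i\cup B_i$; also make $u_i$ and $u'_i$ adjacent to every vertex of $A_i$. Finally add an independent set $Y=\{y_1,y_2,y_3\}$ and make each $y_j$ adjacent to every vertex of $A_i$ and to $x_i$, for all $i$. There are no other edges. The average degree of a graph with $N$ vertices and $m$ edges is $2m/N$. -}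

module Defs where

open import Data.Nat as ℕ using (ℕ; zero; suc; _∸_; _+_; _*_)
open import Data.Fin as Fin using (Fin)
open import Data.Bool using (Bool; true; false; if_then_else_)
open import Data.List using (List; []; _∷_; map; _++_; concatMap; allFin; length)
open import Data.Nat.ListAction using (sum)
open import Data.Integer using (+_)
open import Data.Rational as ℚ using (ℚ; 0ℚ; 1ℚ; _/_)
open import Data.Product using (Σ; ∃; _×_; _,_)
open import Data.Sum using (_⊎_)
open import Relation.Nullary using (¬_)
open import Relation.Nullary.Decidable using (⌊_⌋)
open import Relation.Binary.PropositionalEquality using (_≡_; _≢_)

record Graph : Set where
  field
    n      : ℕ
    adj    : Fin n → Fin n → Bool
    sym    : ∀ i j → adj i j ≡ adj j i
    irrefl : ∀ i → adj i i ≡ false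
open Graph public

Adj : (G : Graph) → Fin (n G) → Fin (n G) → Set
Adj G i j = adj G i j ≡ true

indicator : Bool → ℕ
indicator b = if b then 1 else 0

degree : (G : Graph) → Fin (n G) → ℕ
degree G i = sum (map (λ j → indicator (adj G i j)) (allFin (n G)))

MaxDegree : Graph → ℕ → Set
MaxDegree G k = (∀ i → degree G i ℕ.≤ k) × (∃ λ i → degree G i ≡ k)

data Reach (G : Graph) : Fin (n G) → Fin (n G) → Set where
  here : ∀ {i} → Reach G i i
  step : ∀ {i j k} → Adj G i j → Reach G j k → Reach G i k

Connected : Graph → Set
Connected G = ∀ i j → Reach G i j

-- Planarity: existence of a straight-line crossing-free drawing in the
-- rational plane (equivalent to planarity by Fáry's theorem).

Point : Set
Point = ℚ × ℚ

OnSeg : Point → Point → Point → Set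
OnSeg (px , py) (ax , ay) (bx , by) =
  Σ ℚ λ t → (0ℚ ℚ.≤ t) × (t ℚ.≤ 1ℚ) ×
    (px ≡ ax ℚ.+ t ℚ.* (bx ℚ.- ax)) × (py ≡ ay ℚ.+ t ℚ.* (by ℚ.- ay))

record PlaneEmbedding (G : Graph) : Set where
  field
    pos       : Fin (n G) → Point
    injective : ∀ v w → pos v ≡ pos w → v ≡ w
    vertexOff : ∀ a b v → Adj G a b → v ≢ a → v ≢ b →
                ¬ OnSeg (pos v) (pos a) (pos b)
    noCross   : ∀ a b c d → Adj G a b → Adj G c d →
                ¬ (a ≡ c × b ≡ d) → ¬ (a ≡ d × b ≡ c) →
                ∀ p → OnSeg p (pos a) (pos b) → OnSeg p (pos c) (pos d) →
                ∃ λ w → (w ≡ a ⊎ w ≡ b) × (w ≡ c ⊎ w ≡ d) × (p ≡ pos w)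

Planar : Graph → Set
Planar G = PlaneEmbedding G

data V* (m : ℕ) : Set where
  y  : Fin 3 → V* m
  u  : Fin m → V* m
  u' : Fin m → V* m
  x  : Fin m → V* m
  xa : Fin m → Fin (m ∸ 1) → V* m         -- x_{i,k} ∈ A_i
  xb : Fin m → Fin (m + 2) → V* m         -- x'_{i,k} ∈ B_i

module _ (G : Graph) where
  private
    N = n G
    eq : Fin N → Fin N → Bool
    eq i j = ⌊ i Fin.≟ j ⌋

  adj* : V* N → V* N → Bool
  adj* (u i)  (u j)  = adj G i j
  adj* (u' i) (u' j) = adj G i j
  adj* (u i)  (u' j) = adj G i j
  adj* (u' i) (u j)  = adj G i j
  adj* (x i)  (xa j _) = eq i j
  adj* (xa j _) (x i)  = eq i j
  adj* (x i)  (xb j _) = eq i j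
  adj* (xb j _) (x i)  = eq i j
  adj* (u i)  (xa j _) = eq i j
  adj* (xa j _) (u i)  = eq i j
  adj* (u' i) (xa j _) = eq i j
  adj* (xa j _) (u' i) = eq i j
  adj* (y _)  (xa _ _) = true
  adj* (xa _ _) (y _)  = true
  adj* (y _)  (x _)    = true
  adj* (x _)  (y _)    = true
  adj* _ _ = false

  vertices* : List (V* N)
  vertices* = map y (allFin 3)
           ++ map u (allFin N)
           ++ map u' (allFin N)
           ++ map x (allFin N)
           ++ concatMap (λ i → map (xa i) (allFin (N ∸ 1))) (allFin N)
           ++ concatMap (λ i → map (xb i) (allFin (N + 2))) (allFin N)

-- Number of edges of a graph given by a (symmetric, irreflexive)
-- adjacency function on a duplicate-free enumeration of its vertices:
-- the number of unordered pairs {v,w} of listed vertices that are adjacent.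

edgeCount : {V : Set} → (V → V → Bool) → List V → ℕ
edgeCount a []       = 0
edgeCount a (v ∷ vs) = sum (map (λ w → indicator (a v w)) vs) + edgeCount a vs

averageDegree : {V : Set} → (V → V → Bool) → (vs : List V) →
                .{{_ : ℕ.NonZero (length vs)}} → ℚ
averageDegree a vs = (+ (2 * edgeCount a vs)) / length vs

averageDegree* : Graph → ℚ
averageDegree* G = averageDegree (adj* G) (vertices* G)

{-# OPTIONS --safe #-}
-- Only Δ(G) ≤ 4 is used. By the handshake lemma
-- 2|E(G*)| is the degree sum of G*. With n = |V(G)|, y_j has degree n + n(n-1), u_i and u'_i
-- at most 8 + (n-1), x_i has 3 + (n-1) + (n+2), the vertices of A_i have degree 6 and those of
-- B_i degree 1. Summing gives 2|E(G*)| ≤ 14n² + 14n ≤ 7(2n² + 4n + 3) = 7|V(G*)|.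
module Submission where

open import Defs hiding (sym)
open import Data.Integer using (+_)
open import Data.Rational using (_≤_; _/_)

open import Data.Bool using (Bool; false)
open import Data.Fin using (Fin; zero; suc; _≟_)
open import Data.Fin.Properties using (suc-injective)
open import Data.List using (List; []; _∷_; map; _++_; concatMap; allFin; length)
open import Data.List.Properties using (map-++; map-∘; map-tabulate; length-tabulate)
open import Data.Nat as ℕ using (ℕ; zero; suc; _+_; _*_; _∸_; NonZero)
open import Data.Nat.ListAction using (sum)
open import Data.Nat.ListAction.Properties using (sum-++)
open import Data.Nat.Properties using (+-mono-≤; +-identityʳ; +-commutativeSemigroup; ≤-trans; ≤-reflexive; m≤m+n; m∸n≤m; *-identityʳ; *-comm; m≤n⇒∃[o]m+o≡n; module ≤-Reasoning)
open import Algebra.Properties.CommutativeSemigroup +-commutativeSemigroup using (interchange)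
open import Data.Nat.Tactic.RingSolver using (solve; solve-∀)
open import Data.Product using (_,_)
open import Function using (_∘_; id)
open import Relation.Nullary.Decidable using (⌊_⌋; isYes≗does; dec-true; dec-false)
open import Relation.Binary.PropositionalEquality
import Data.Integer as ℤ
import Data.Integer.Properties as ℤₚ
import Data.Rational as ℚ
import Data.Rational.Properties as ℚₚ
import Data.Rational.Unnormalised as ℚᵘ
import Data.Rational.Unnormalised.Properties as ℚᵘₚ

∑ : {A : Set} → List A → (A → ℕ) → ℕ
∑ as g = sum (map g as)

module _ {A : Set} where

  ∑-++ : ∀ (as bs : List A) {g} → ∑ (as ++ bs) g ≡ ∑ as g + ∑ bs g
  ∑-++ as bs {g} = trans (cong sum (map-++ g as bs)) (sum-++ (map g as) (map g bs))

  ∑-map : ∀ {B : Set} (h : B → A) bs {g} → ∑ (map h bs) g ≡ ∑ bs (g ∘ h)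
  ∑-map h bs = cong sum (sym (map-∘ bs))

  ∑-concatMap : ∀ {B : Set} (h : B → List A) bs {g} →
                ∑ (concatMap h bs) g ≡ ∑ bs (λ b → ∑ (h b) g)
  ∑-concatMap h []       = refl
  ∑-concatMap h (b ∷ bs) =
    trans (∑-++ (h b) (concatMap h bs)) (cong (_+_ (∑ (h b) _)) (∑-concatMap h bs))

  ∑-cong : ∀ {g h : A → ℕ} → (∀ a → g a ≡ h a) → ∀ as → ∑ as g ≡ ∑ as h
  ∑-cong g≗h []       = refl
  ∑-cong g≗h (a ∷ as) = cong₂ _+_ (g≗h a) (∑-cong g≗h as)

  ∑-mono-≤ : ∀ {g h : A → ℕ} → (∀ a → g a ℕ.≤ h a) → ∀ as → ∑ as g ℕ.≤ ∑ as h
  ∑-mono-≤ g≤h []       = ℕ.z≤n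
  ∑-mono-≤ g≤h (a ∷ as) = +-mono-≤ (g≤h a) (∑-mono-≤ g≤h as)

  ∑-+ : ∀ (g h : A → ℕ) as → ∑ as (λ a → g a + h a) ≡ ∑ as g + ∑ as h
  ∑-+ g h []       = refl
  ∑-+ g h (a ∷ as) = trans (cong (_+_ (g a + h a)) (∑-+ g h as)) (interchange (g a) (h a) _ _)

  ∑-zero : ∀ {g : A → ℕ} → (∀ a → g a ≡ 0) → ∀ as → ∑ as g ≡ 0
  ∑-zero g≗0 []       = refl
  ∑-zero g≗0 (a ∷ as) = cong₂ _+_ (g≗0 a) (∑-zero g≗0 as)

  ∑-const : ∀ (as : List A) c → ∑ as (λ _ → c) ≡ length as * c
  ∑-const []       c = refl
  ∑-const (a ∷ as) c = cong (_+_ c) (∑-const as c)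

∑-allFin-suc : ∀ {m} (f : Fin (suc m) → ℕ) → ∑ (allFin (suc m)) f ≡ f zero + ∑ (allFin m) (f ∘ suc)
∑-allFin-suc f =
  cong (λ fs → f zero + sum fs) (trans (map-tabulate suc f) (sym (map-tabulate id (f ∘ suc))))

∑-allFin-const : ∀ m c → ∑ (allFin m) (λ _ → c) ≡ m * c
∑-allFin-const m c = trans (∑-const (allFin m) c) (cong (_* c) (length-tabulate {n = m} id))

∑-allFin-one : ∀ m → ∑ (allFin m) (λ _ → 1) ≡ m
∑-allFin-one m = trans (∑-allFin-const m 1) (*-identityʳ m)

∑-allFin-single : ∀ {m} (f : Fin m → ℕ) i → (∀ j → j ≢ i → f j ≡ 0) → ∑ (allFin m) f ≡ f i
∑-allFin-single f zero off =
  trans (∑-allFin-suc f)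
        (trans (cong (_+_ (f zero)) (∑-zero (λ j → off (suc j) λ ()) (allFin _))) (+-identityʳ (f zero)))
∑-allFin-single f (suc i) off =
  trans (∑-allFin-suc f)
        (cong₂ _+_ (off zero λ ()) (∑-allFin-single (f ∘ suc) i λ j j≢i → off (suc j) (j≢i ∘ suc-injective)))

δ : ∀ {m} → Fin m → Fin m → ℕ
δ i j = indicator ⌊ i ≟ j ⌋

δ-refl : ∀ {m} (i : Fin m) → δ i i ≡ 1
δ-refl i = cong indicator (trans (isYes≗does (i ≟ i)) (dec-true (i ≟ i) refl))

δ-≢ : ∀ {m} {i j : Fin m} → i ≢ j → δ i j ≡ 0
δ-≢ {i = i} {j} i≢j = cong indicator (trans (isYes≗does (i ≟ j)) (dec-false (i ≟ j) i≢j))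

∑-δ : ∀ {m} (j : Fin m) → ∑ (allFin m) (λ i → δ i j) ≡ 1
∑-δ j = trans (∑-allFin-single (λ i → δ i j) j λ i → δ-≢) (δ-refl j)

degreeIn : {A : Set} → (A → A → Bool) → List A → A → ℕ
degreeIn a vs v = ∑ vs (λ w → indicator (a v w))

handshake : ∀ {A : Set} {a : A → A → Bool} → (∀ v w → a v w ≡ a w v) → (∀ v → a v v ≡ false) →
            ∀ vs → 2 * edgeCount a vs ≡ ∑ vs (degreeIn a vs)
handshake             a-sym a-irr []       = refl
handshake {a = a} a-sym a-irr (v ∷ ws) = begin
  2 * (d v + edgeCount a ws)
    ≡⟨ double-sum (d v) _ ⟩
  d v + (d v + 2 * edgeCount a ws)
    ≡⟨ cong (λ s → d v + (d v + s)) (handshake a-sym a-irr ws) ⟩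
  d v + (d v + ∑ ws d)
    ≡⟨ cong (λ s → d v + (s + ∑ ws d)) (∑-cong (λ w → cong indicator (a-sym w v)) ws) ⟨
  d v + (∑ ws (λ w → indicator (a w v)) + ∑ ws d)
    ≡⟨ cong₂ _+_ (cong (λ b → indicator b + d v) (a-irr v)) (∑-+ _ d ws) ⟨
  indicator (a v v) + d v + ∑ ws (λ w → indicator (a w v) + d w) ∎
  where
  open ≡-Reasoning
  d = degreeIn a ws
  double-sum : ∀ p q → 2 * (p + q) ≡ p + (p + 2 * q)
  double-sum = solve-∀

adj*-sym : (G : Graph) → ∀ v w → adj* G v w ≡ adj* G w v
adj*-sym G (y _) (y _)       = refl
adj*-sym G (y _) (u _)       = refl
adj*-sym G (y _) (u' _)      = refl
adj*-sym G (y _) (x _)       = refl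
adj*-sym G (y _) (xa _ _)    = refl
adj*-sym G (y _) (xb _ _)    = refl
adj*-sym G (u _) (y _)       = refl
adj*-sym G (u i) (u j)       = Graph.sym G i j
adj*-sym G (u i) (u' j)      = Graph.sym G i j
adj*-sym G (u _) (x _)       = refl
adj*-sym G (u _) (xa _ _)    = refl
adj*-sym G (u _) (xb _ _)    = refl
adj*-sym G (u' _) (y _)      = refl
adj*-sym G (u' i) (u j)      = Graph.sym G i j
adj*-sym G (u' i) (u' j)     = Graph.sym G i j
adj*-sym G (u' _) (x _)      = refl
adj*-sym G (u' _) (xa _ _)   = refl
adj*-sym G (u' _) (xb _ _)   = refl
adj*-sym G (x _) (y _)       = refl
adj*-sym G (x _) (u _)       = refl
adj*-sym G (x _) (u' _)      = refl
adj*-sym G (x _) (x _)       = refl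
adj*-sym G (x _) (xa _ _)    = refl
adj*-sym G (x _) (xb _ _)    = refl
adj*-sym G (xa _ _) (y _)    = refl
adj*-sym G (xa _ _) (u _)    = refl
adj*-sym G (xa _ _) (u' _)   = refl
adj*-sym G (xa _ _) (x _)    = refl
adj*-sym G (xa _ _) (xa _ _) = refl
adj*-sym G (xa _ _) (xb _ _) = refl
adj*-sym G (xb _ _) (y _)    = refl
adj*-sym G (xb _ _) (u _)    = refl
adj*-sym G (xb _ _) (u' _)   = refl
adj*-sym G (xb _ _) (x _)    = refl
adj*-sym G (xb _ _) (xa _ _) = refl
adj*-sym G (xb _ _) (xb _ _) = refl

adj*-irrefl : (G : Graph) → ∀ v → adj* G v v ≡ false
adj*-irrefl G (y _)    = refl
adj*-irrefl G (u i)    = irrefl G i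
adj*-irrefl G (u' i)   = irrefl G i
adj*-irrefl G (x _)    = refl
adj*-irrefl G (xa _ _) = refl
adj*-irrefl G (xb _ _) = refl

module _ {m : ℕ} where

  ∑* : (V* m → ℕ) → ℕ
  ∑* g = ∑ (allFin 3) (g ∘ y)
       + (∑ (allFin m) (g ∘ u)
       + (∑ (allFin m) (g ∘ u')
       + (∑ (allFin m) (g ∘ x)
       + (∑ (allFin m) (λ i → ∑ (allFin (m ∸ 1)) (g ∘ xa i))
       +  ∑ (allFin m) (λ i → ∑ (allFin (m + 2)) (g ∘ xb i))))))

  blockwise : (cy cu cu' cx ca cb : ℕ) → V* m → ℕ
  blockwise cy cu cu' cx ca cb (y _)    = cy
  blockwise cy cu cu' cx ca cb (u _)    = cu
  blockwise cy cu cu' cx ca cb (u' _)   = cu'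
  blockwise cy cu cu' cx ca cb (x _)    = cx
  blockwise cy cu cu' cx ca cb (xa _ _) = ca
  blockwise cy cu cu' cx ca cb (xb _ _) = cb

  ∑*-blockwise : ∀ cy cu cu' cx ca cb → ∑* (blockwise cy cu cu' cx ca cb) ≡
    3 * cy + (m * cu + (m * cu' + (m * cx + (m * ((m ∸ 1) * ca) + m * ((m + 2) * cb)))))
  ∑*-blockwise cy cu cu' cx ca cb =
    cong₂ _+_ (∑-allFin-const 3 cy) (cong₂ _+_ (∑-allFin-const m cu) (cong₂ _+_ (∑-allFin-const m cu')
      (cong₂ _+_ (∑-allFin-const m cx) (cong₂ _+_ (nested (m ∸ 1) ca) (nested (m + 2) cb)))))
    where
    nested : ∀ k c → ∑ (allFin m) (λ _ → ∑ (allFin k) (λ _ → c)) ≡ m * (k * c)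
    nested k c = trans (∑-allFin-const m _) (cong (m *_) (∑-allFin-const k c))

∑-vertices* : (G : Graph) (g : V* (n G) → ℕ) → ∑ (vertices* G) g ≡ ∑* g
∑-vertices* G g =
  split Y  (U ++ U′ ++ X ++ A ++ B) (flat y) (
  split U  (U′ ++ X ++ A ++ B)      (flat u) (
  split U′ (X ++ A ++ B)            (flat u') (
  split X  (A ++ B)                 (flat x) (
  split A  B                        (nested xa) (nested xb)))))
  where
  N = n G
  Y = map y (allFin 3)
  U = map u (allFin N)
  U′ = map u' (allFin N)
  X = map x (allFin N)
  A = concatMap (λ i → map (xa i) (allFin (N ∸ 1))) (allFin N)
  B = concatMap (λ i → map (xb i) (allFin (N + 2))) (allFin N)
  split : ∀ as bs {s t} → ∑ as g ≡ s → ∑ bs g ≡ t → ∑ (as ++ bs) g ≡ s + t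
  split as bs p q = trans (∑-++ as bs) (cong₂ _+_ p q)
  flat : ∀ {k} (h : Fin k → V* N) → ∑ (map h (allFin k)) g ≡ ∑ (allFin k) (g ∘ h)
  flat h = ∑-map h (allFin _)
  nested : ∀ {k} (h : Fin N → Fin k → V* N) →
           ∑ (concatMap (λ i → map (h i) (allFin k)) (allFin N)) g ≡ ∑ (allFin N) (λ i → ∑ (allFin k) (g ∘ h i))
  nested h = trans (∑-concatMap _ (allFin N)) (∑-cong (λ i → flat (h i)) (allFin N))

degreeBound* : ∀ {m} → V* m → ℕ
degreeBound* {m} = blockwise (m + m * d) (8 + d) (8 + d) (3 + d + (m + 2)) 6 1
  where d = m ∸ 1

degree*-≤ : (G : Graph) → (∀ i → degree G i ℕ.≤ 4) →
            ∀ v → degreeIn (adj* G) (vertices* G) v ℕ.≤ degreeBound* v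
degree*-≤ G Δ≤4 v = ≤-trans (≤-reflexive (∑-vertices* G (λ w → indicator (adj* G v w)))) (neighbours v)
  where
  N = n G
  infixr 6 _⊕_
  _⊕_ : ∀ {a b c d} → a ℕ.≤ b → c ℕ.≤ d → a + c ℕ.≤ b + d
  _⊕_ = +-mono-≤

  zeros : ∀ k → ∑ (allFin k) (λ _ → 0) ℕ.≤ 0
  zeros k = ≤-reflexive (∑-zero (λ _ → refl) (allFin k))
  zeros² : ∀ k → ∑ (allFin N) (λ _ → ∑ (allFin k) (λ _ → 0)) ℕ.≤ 0
  zeros² k = ≤-reflexive (∑-zero (λ _ → ∑-zero (λ _ → refl) (allFin k)) (allFin N))
  ones : ∀ k → ∑ (allFin k) (λ _ → 1) ℕ.≤ k
  ones k = ≤-reflexive (∑-allFin-one k)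
  ones² : ∀ k → ∑ (allFin N) (λ _ → ∑ (allFin k) (λ _ → 1)) ℕ.≤ N * k
  ones² k = ≤-reflexive (trans (∑-allFin-const N _) (cong (N *_) (∑-allFin-one k)))
  single : ∀ j → ∑ (allFin N) (λ i → δ i j) ℕ.≤ 1
  single j = ≤-reflexive (∑-δ j)
  single² : ∀ k i → ∑ (allFin N) (λ j → ∑ (allFin k) (λ _ → δ i j)) ℕ.≤ k
  single² k i = ≤-reflexive (begin
    ∑ (allFin N) (λ j → ∑ (allFin k) (λ _ → δ i j))
      ≡⟨ ∑-allFin-single _ i (λ j j≢i → ∑-zero (λ _ → δ-≢ (≢-sym j≢i)) (allFin k)) ⟩
    ∑ (allFin k) (λ _ → δ i i)
      ≡⟨ ∑-cong (λ _ → δ-refl i) (allFin k) ⟩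
    ∑ (allFin k) (λ _ → 1)
      ≡⟨ ∑-allFin-one k ⟩
    k ∎)
    where open ≡-Reasoning
  -- `_ ⊕ zeros² (N + 2)` would leave a `b + 0` that does not reduce to the entry of degreeBound*.
  _⊕zerosB : ∀ {a b} → a ℕ.≤ b → a + ∑ (allFin N) (λ _ → ∑ (allFin (N + 2)) (λ _ → 0)) ℕ.≤ b
  a≤b ⊕zerosB = ≤-trans (+-mono-≤ a≤b (zeros² (N + 2))) (≤-reflexive (+-identityʳ _))

  neighbours : ∀ v → ∑* (λ w → indicator (adj* G v w)) ℕ.≤ degreeBound* v
  neighbours (y _)    = zeros 3 ⊕ zeros N ⊕ zeros N ⊕ ones N ⊕ ones² (N ∸ 1) ⊕zerosB
  neighbours (u i)    = zeros 3 ⊕ Δ≤4 i ⊕ Δ≤4 i ⊕ zeros N ⊕ single² (N ∸ 1) i ⊕zerosB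
  neighbours (u' i)   = zeros 3 ⊕ Δ≤4 i ⊕ Δ≤4 i ⊕ zeros N ⊕ single² (N ∸ 1) i ⊕zerosB
  neighbours (x i)    = ones 3 ⊕ zeros N ⊕ zeros N ⊕ zeros N ⊕ single² (N ∸ 1) i ⊕ single² (N + 2) i
  neighbours (xa j _) = ones 3 ⊕ single j ⊕ single j ⊕ single j ⊕ zeros² (N ∸ 1) ⊕zerosB
  neighbours (xb j _) = zeros 3 ⊕ zeros N ⊕ zeros N ⊕ single j ⊕ zeros² (N ∸ 1) ⊕zerosB

-- The difference of the two sides is 21 + 9m + 5m(m - d), so only d ≤ m is needed, not d = m ∸ 1.
degreeBound*-arithmetic : ∀ m d → d ℕ.≤ m →
  3 * (m + m * d) + (m * (8 + d) + (m * (8 + d) + (m * (3 + d + (m + 2)) + (m * (d * 6) + m * ((m + 2) * 1)))))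
    ℕ.≤ 3 * 7 + (m * 7 + (m * 7 + (m * 7 + (m * (d * 7) + m * ((m + 2) * 7)))))
degreeBound*-arithmetic m d d≤m with m≤n⇒∃[o]m+o≡n d≤m
... | t , refl =
  ≤-trans (m≤m+n _ (21 + 9 * (d + t) + 5 * (d + t) * t)) (≤-reflexive (solve (d ∷ t ∷ [])))

∑*-degreeBound*-≤ : ∀ m → ∑* {m} degreeBound* ℕ.≤ ∑* {m} (λ _ → 7)
∑*-degreeBound*-≤ m = begin
  ∑* {m} degreeBound* ≡⟨ ∑*-blockwise {m} (m + m * d) (8 + d) (8 + d) (3 + d + (m + 2)) 6 1 ⟩
  _                   ≤⟨ degreeBound*-arithmetic m d (m∸n≤m m 1) ⟩
  _                   ≡⟨ ∑*-blockwise {m} 7 7 7 7 7 7 ⟨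
  ∑* {m} (λ _ → 7)    ∎
  where
  open ≤-Reasoning
  d = m ∸ 1

fromℚᵘ-mono-≤ : ∀ {p q} → p ℚᵘ.≤ q → ℚ.fromℚᵘ p ≤ ℚ.fromℚᵘ q
fromℚᵘ-mono-≤ {p} {q} p≤q = ℚₚ.toℚᵘ-cancel-≤
  (ℚᵘₚ.≤-respʳ-≃ (ℚᵘₚ.≃-sym (ℚₚ.toℚᵘ-fromℚᵘ q))
    (ℚᵘₚ.≤-respˡ-≃ (ℚᵘₚ.≃-sym (ℚₚ.toℚᵘ-fromℚᵘ p)) p≤q))

a*d≤c*b⇒a/b≤c/d : ∀ a b c d .{{_ : NonZero b}} .{{_ : NonZero d}} →
                   a * d ℕ.≤ c * b → (+ a) / b ≤ (+ c) / d
a*d≤c*b⇒a/b≤c/d a (suc b) c (suc d) ad≤cb =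
  fromℚᵘ-mono-≤ {ℚᵘ.mkℚᵘ (+ a) b} {ℚᵘ.mkℚᵘ (+ c) d}
    (ℚᵘ.*≤* (subst₂ ℤ._≤_ (ℤₚ.pos-* a (suc d)) (ℤₚ.pos-* c (suc b)) (ℤ.+≤+ ad≤cb)))

lemma9 : (G : Graph) → Connected G → Planar G → MaxDegree G 4 →
    averageDegree* G ≤ (+ 7) / 1
lemma9 G _ _ (Δ≤4 , _) = a*d≤c*b⇒a/b≤c/d (2 * edgeCount (adj* G) vs) (length vs) 7 1 (begin
  2 * edgeCount (adj* G) vs * 1  ≡⟨ *-identityʳ _ ⟩
  2 * edgeCount (adj* G) vs      ≡⟨ handshake (adj*-sym G) (adj*-irrefl G) vs ⟩
  ∑ vs (degreeIn (adj* G) vs)    ≤⟨ ∑-mono-≤ (degree*-≤ G Δ≤4) vs ⟩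
  ∑ vs degreeBound*              ≡⟨ ∑-vertices* G degreeBound* ⟩
  ∑* {n G} degreeBound*          ≤⟨ ∑*-degreeBound*-≤ (n G) ⟩
  ∑* {n G} (λ _ → 7)             ≡⟨ ∑-vertices* G (λ _ → 7) ⟨
  ∑ vs (λ _ → 7)                 ≡⟨ ∑-const vs 7 ⟩
  length vs * 7                  ≡⟨ *-comm (length vs) 7 ⟩
  7 * length vs                  ∎)
  where
  open ≤-Reasoning
  vs = vertices* G
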